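{- Let $m\ge1$ and $$T_1(m)=\frac{2m-1+\sqrt{16m^2-14m+3}}{3m-1}.$$ Consider instances in which every job has testing time $t_j=1$. The Uniform-SBS algorithm sorts the jobs by non-increasing upper bound $u_j$, and goes through this sorted list placing each job on a currently least-loaded machine, testing the job if $u_j\ge T_1(m)$ and running it untested otherwise. Then Uniform-SBS is $T_1(m)\left(\frac32-\frac1{2m}\right)$-competitive for non-preemptive makespan minimization on $m$ identical machines with testing on such uniform instances.
   Context: Scheduling with testing on $m$ identical parallel machines: there are $n$ jobs; each job $j$ has a testing time $t_j\ge 0$, an upper bound $u_j\ge 0$ and a processing time $p_j$ with $0\le p_j\le u_j$. A job can either be run untested, occupying a machine for time $u_j$, or be tested and then executed, occupying a machine for total time $t_j+p_j$; the value $p_j$ is revealed to the algorithm only when the test of $j$ is completed. Initially the algorithm knows $m$, $n$ and all $t_j,u_j$, but not the $p_j$. In the non-preemptive setting each job is assigned to a single machine and run there without interruption. The objective is the makespan (maximum machine load). $\mathrm{OPT}$ denotes the minimum makespan achievable by an offline scheduler knowing all $p_j$ (job $j$ needs time $\min(t_j+p_j,u_j)$ in the optimum). A deterministic algorithm is $c$-competitive if its makespan $\mathrm{ALG}$ satisfies $\mathrm{ALG}\le c\cdot\mathrm{OPT}$ on every instance (here: every instance with all $t_j=1$).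
   Formalization: The upper bounds $u_j$ and the processing times $p_j$ take values in the rationals. -}

module Defs where

open import Data.Nat as ℕ using (ℕ)
open import Data.Integer using (+_)
open import Data.Rational using (ℚ; _/_; 0ℚ; 1ℚ; _+_; _-_; _*_; _≤_; _⊔_)
open import Data.Fin using (Fin; _≟_)
open import Data.Fin.Properties using ()
open import Data.List using (List; []; _∷_; foldr; map; allFin)
open import Data.List.Relation.Binary.Permutation.Propositional using (_↭_)
open import Data.List.Relation.Unary.Linked using (Linked)
open import Data.Product using (_×_)
open import Data.Sum using (_⊎_)
open import Data.Bool using (if_then_else_)
open import Relation.Nullary using (¬_)
open import Relation.Nullary.Decidable using (⌊_⌋)

ℕ→ℚ : ℕ → ℚ
ℕ→ℚ k = + k / 1

-- T₁(m) = (a + √D) / b  with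
--   a = 2m-1,  b = 3m-1,  D = 16m²-14m+3   (D > 0 and b > 0 for m ≥ 1)
aT : ℕ → ℚ
aT m = ℕ→ℚ (2 ℕ.* m) - 1ℚ

bT : ℕ → ℚ
bT m = ℕ→ℚ (3 ℕ.* m) - 1ℚ

DT : ℕ → ℚ
DT m = ℕ→ℚ (16 ℕ.* m ℕ.* m ℕ.+ 3) - ℕ→ℚ (14 ℕ.* m)

-- "x ≥ T₁(m)", i.e. b·x - a ≥ √D, written exactly without reals:
-- (b x - a ≥ 0) and (b x - a)² ≥ D.
GeT1 : ℕ → ℚ → Set
GeT1 m x = (0ℚ ≤ bT m * x - aT m) × (DT m ≤ (bT m * x - aT m) * (bT m * x - aT m))

-- "z ≤ T₁(m)·(3/2 - 1/(2m))·y" for y ≥ 0.  Since T₁(m)(3/2-1/(2m)) = (a+√D)/(2m),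
-- this is  2m·z - a·y ≤ √D·y,  i.e. (LHS ≤ 0) or (LHS² ≤ D·y²).
LeRatio : ℕ → ℚ → ℚ → Set
LeRatio m z y =
  (w ≤ 0ℚ) ⊎ (w * w ≤ DT m * (y * y))
  where
  w = ℕ→ℚ (2 ℕ.* m) * z - aT m * y

-- maximum of a load vector (loads are nonnegative, so starting at 0 is harmless)
makespan : {m : ℕ} → (Fin m → ℚ) → ℚ
makespan {m} L = foldr _⊔_ 0ℚ (map L (allFin m))

minℚ : ℚ → ℚ → ℚ
minℚ x y = Data.Rational._⊓_ x y

-- Offline schedule: an assignment σ of jobs to machines; job j needs
-- min(t_j + p_j, u_j) with t_j = 1.
offlineLoad : {m n : ℕ} → (u p : Fin n → ℚ) → (Fin n → Fin m) → Fin m → ℚ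
offlineLoad {m} {n} u p σ k =
  foldr (λ j acc → (if ⌊ σ j ≟ k ⌋ then minℚ (1ℚ + p j) (u j) else 0ℚ) + acc)
        0ℚ (allFin n)

addLoad : {m : ℕ} → (Fin m → ℚ) → Fin m → ℚ → (Fin m → ℚ)
addLoad L i d k = if ⌊ k ≟ i ⌋ then L k + d else L k

-- Uniform-SBS run (non-deterministic in tie-breaking): processing a job list
-- from loads L ends in loads L'.
data SBSRun (m : ℕ) {n : ℕ} (u p : Fin n → ℚ) :
            (Fin m → ℚ) → List (Fin n) → (Fin m → ℚ) → Set where
  done   : ∀ L → SBSRun m u p L [] L
  tested : ∀ L j js i L' →
           (∀ k → L i ≤ L k) → GeT1 m (u j) →
           SBSRun m u p (addLoad L i (1ℚ + p j)) js L' →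
           SBSRun m u p L (j ∷ js) L'
  untested : ∀ L j js i L' →
           (∀ k → L i ≤ L k) → ¬ GeT1 m (u j) →
           SBSRun m u p (addLoad L i (u j)) js L' →
           SBSRun m u p L (j ∷ js) L'

SortedOrder : {n : ℕ} → (Fin n → ℚ) → List (Fin n) → Set
SortedOrder {n} u π = (π ↭ allFin n) × Linked (λ i j → u j ≤ u i) π

{-# OPTIONS --safe #-}
-- Put a = 2m − 1, b = 3m − 1, D = 16m² − 14m + 3 = a² + 2ab and σ = a + √D. Then T₁ = σ/b is the
-- positive root of b z² − 2a z − 2a, and the claimed ratio T₁(3/2 − 1/(2m)) is σ/(2m). Every job costs
-- the algorithm at most T₁ times its optimal time min(1 + p, u). Along the run, every machine load L
-- satisfies 2m·L ≤ σ·OPT: when job j goes to a least loaded machine, either some machine is still empty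
-- and the new load is just the cost of j, or at least m jobs precede j. In the latter case two of the
-- first m + 1 jobs, all with upper bound at least u_j, share an optimal machine, so OPT ≥ 2·min(1, u_j),
-- while the least load is at most the average cost of the earlier jobs. For an untested j this closes
-- with u_j ≤ T₁·min(1, u_j). For a tested j all earlier jobs were tested too, each costing at most
-- (1 + 1/u_j) times its optimal time, and the bound reduces to 2m(1 + u_j) + 3(m − 1)u_j ≤ σu_j, which
-- follows for u_j ≥ T₁ from the quadratic equation of T₁ and from 2a ≤ √D.
module Submission where

open import Agda.Builtin.FromNat using (Number; fromNat)
open import Data.Bool using (true; false; if_then_else_)
open import Data.Empty using (⊥-elim)
open import Data.Fin as Fin using (Fin; zero; suc; _≟_; punchIn; punchOut)
import Data.Fin.Properties as Fin
open import Data.Integer as ℤ using ()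
import Data.Integer.Properties as ℤ
open import Data.List as List using (List; []; _∷_; _++_; foldr; map; length; lookup; tabulate; allFin)
import Data.List.Properties as List
open import Data.List.Membership.Propositional using (_∈_)
open import Data.List.Membership.Propositional.Properties using (∈-map⁺; ∈-allFin; ∈-lookup)
open import Data.List.Relation.Binary.Permutation.Propositional using (_↭_; ↭-sym; ↭⇒↭ₛ)
import Data.List.Relation.Binary.Permutation.Propositional.Properties as ↭
import Data.List.Relation.Binary.Permutation.Setoid.Properties as ↭ₛ
open import Data.List.Relation.Unary.All as All using (All)
import Data.List.Relation.Unary.All.Properties as All
import Data.List.Relation.Unary.Any as Any
open import Data.List.Relation.Unary.AllPairs as AllPairs using (AllPairs)
open import Data.List.Relation.Unary.Linked.Properties using (Linked⇒AllPairs)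
open import Data.List.Relation.Unary.Unique.Propositional using (Unique)
open import Data.List.Relation.Unary.Unique.Propositional.Properties using (allFin⁺)
open import Data.Maybe using (just; nothing)
open import Data.Nat as ℕ using (ℕ; zero; suc; _≥_)
import Data.Nat.Coprimality as Coprime
import Data.Nat.Literals
import Data.Nat.Properties as ℕ
open import Data.Product using (∃; ∃₂; _×_; _,_; proj₁; proj₂)
open import Data.Rational
  using (ℚ; mkℚ; _/_; 0ℚ; 1ℚ; _+_; _*_; -_; _-_; _≤_; _<_; _⊓_; _⊔_; nonNegative; positive)
import Data.Rational.Literals
open import Data.Rational.Properties hiding (_≟_)
import Data.Rational.Properties as ℚ using (_≟_)
open import Data.Sign using (Sign)
open import Data.Sum using (_⊎_; inj₁; inj₂; [_,_]′)
open import Data.Unit using (tt)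
open import Function using (_∘_; id)
open import Level using (0ℓ)
open import Relation.Binary.PropositionalEquality
open import Relation.Nullary using (¬_; Dec; yes; no)
open import Relation.Nullary.Decidable using (⌊_⌋; _×-dec_)
open import Relation.Unary using (Pred; Decidable)
open import Tactic.RingSolver using (solve)
open import Tactic.RingSolver.Core.AlmostCommutativeRing using (AlmostCommutativeRing; fromCommutativeRing)
open import Algebra.Properties.CommutativeMonoid.Sum +-0-commutativeMonoid
  using (sum; ∑-comm; sum-remove; sum-cong-≗; sum-replicate-zero)

open import Defs

instance
  ℕ-number : Number ℕ
  ℕ-number = Data.Nat.Literals.number

  ℚ-number : Number ℚ
  ℚ-number = Data.Rational.Literals.number

private
  variable
    k n : ℕ
    d p q r t u v v′ w w′ w₁ w₂ x y y′ y₁ y₂ z z′ z₁ z₂ : ℚ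
    f g : Fin n → ℚ

-- Rational arithmetic

ℚ-ring : AlmostCommutativeRing 0ℓ 0ℓ
ℚ-ring = fromCommutativeRing +-*-commutativeRing isZero
  where
  isZero : ∀ x → _
  isZero x with 0ℚ ℚ.≟ x
  ... | yes 0≡x = just 0≡x
  ... | no _    = nothing

-- 1ℚ + k/1 computes to (+1 + (+ ◃ k·1))/1, which is stuck on k·1.
ℕ→ℚ-suc : ∀ k → ℕ→ℚ (suc k) ≡ 1ℚ + ℕ→ℚ k
ℕ→ℚ-suc k = begin
  ℕ→ℚ (suc k)                            ≡⟨ cong (λ i → (ℤ.+ 1 ℤ.+ i) / 1) +k≡+◃k*1 ⟩
  (ℤ.+ 1 ℤ.+ (Sign.+ ℤ.◃ k ℕ.* 1)) / 1   ≡⟨⟩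
  1ℚ + mkℚ (ℤ.+ k) 0 k/1-coprime          ≡⟨ cong (1ℚ +_) (normalize-coprime k/1-coprime) ⟨
  1ℚ + ℕ→ℚ k                             ∎
  where
  open ≡-Reasoning
  k/1-coprime = Coprime.sym (Coprime.1-coprimeTo k)
  +k≡+◃k*1 : ℤ.+ k ≡ Sign.+ ℤ.◃ k ℕ.* 1
  +k≡+◃k*1 = sym (trans (ℤ.+◃n≡+n (k ℕ.* 1)) (cong ℤ.+_ (ℕ.*-identityʳ k)))

ℕ→ℚ-+ : ∀ x y → ℕ→ℚ (x ℕ.+ y) ≡ ℕ→ℚ x + ℕ→ℚ y
ℕ→ℚ-+ zero    y = sym (+-identityˡ (ℕ→ℚ y))
ℕ→ℚ-+ (suc x) y = begin
  ℕ→ℚ (suc (x ℕ.+ y))          ≡⟨ ℕ→ℚ-suc (x ℕ.+ y) ⟩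
  1ℚ + ℕ→ℚ (x ℕ.+ y)           ≡⟨ cong (1ℚ +_) (ℕ→ℚ-+ x y) ⟩
  1ℚ + (ℕ→ℚ x + ℕ→ℚ y)         ≡⟨ +-assoc 1ℚ (ℕ→ℚ x) (ℕ→ℚ y) ⟨
  (1ℚ + ℕ→ℚ x) + ℕ→ℚ y         ≡⟨ cong (_+ ℕ→ℚ y) (ℕ→ℚ-suc x) ⟨
  ℕ→ℚ (suc x) + ℕ→ℚ y          ∎
  where open ≡-Reasoning

ℕ→ℚ-* : ∀ x y → ℕ→ℚ (x ℕ.* y) ≡ ℕ→ℚ x * ℕ→ℚ y
ℕ→ℚ-* zero    y = sym (*-zeroˡ (ℕ→ℚ y))
ℕ→ℚ-* (suc x) y = begin
  ℕ→ℚ (y ℕ.+ x ℕ.* y)          ≡⟨ ℕ→ℚ-+ y (x ℕ.* y) ⟩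
  ℕ→ℚ y + ℕ→ℚ (x ℕ.* y)        ≡⟨ cong₂ _+_ (*-identityˡ (ℕ→ℚ y)) (sym (ℕ→ℚ-* x y)) ⟨
  1ℚ * ℕ→ℚ y + ℕ→ℚ x * ℕ→ℚ y   ≡⟨ *-distribʳ-+ (ℕ→ℚ y) 1ℚ (ℕ→ℚ x) ⟨
  (1ℚ + ℕ→ℚ x) * ℕ→ℚ y         ≡⟨ cong (_* ℕ→ℚ y) (ℕ→ℚ-suc x) ⟨
  ℕ→ℚ (suc x) * ℕ→ℚ y          ∎
  where open ≡-Reasoning

0≤1 : 0ℚ ≤ 1ℚ
0≤1 = nonNegative⁻¹ 1ℚ

0≤2 : 0ℚ ≤ 2
0≤2 = nonNegative⁻¹ 2

0≤* : 0ℚ ≤ p → 0ℚ ≤ q → 0ℚ ≤ p * q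
0≤* {p} {q} 0≤p 0≤q =
  nonNegative⁻¹ (p * q) {{nonNeg*nonNeg⇒nonNeg p {{nonNegative 0≤p}} q {{nonNegative 0≤q}}}}

*-monoˡ-≤-nonNeg′ : 0ℚ ≤ r → p ≤ q → r * p ≤ r * q
*-monoˡ-≤-nonNeg′ {r} 0≤r = *-monoˡ-≤-nonNeg r {{nonNegative 0≤r}}

*-monoʳ-≤-nonNeg′ : 0ℚ ≤ r → p ≤ q → p * r ≤ q * r
*-monoʳ-≤-nonNeg′ {r} 0≤r = *-monoʳ-≤-nonNeg r {{nonNegative 0≤r}}

*-cancelˡ-≤-pos′ : 0ℚ < r → r * p ≤ r * q → p ≤ q
*-cancelˡ-≤-pos′ {r} 0<r = *-cancelˡ-≤-pos r {{positive 0<r}}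

p≤p+q : 0ℚ ≤ q → p ≤ p + q
p≤p+q {q} {p} 0≤q = subst (_≤ p + q) (+-identityʳ p) (+-monoʳ-≤ p 0≤q)

≤-by-gap : ∀ g → 0ℚ ≤ g → q ≡ p + g → p ≤ q
≤-by-gap {q} {p} g 0≤g refl = p≤p+q 0≤g

0≤*-cancelˡ : 0ℚ < r → 0ℚ ≤ r * p → 0ℚ ≤ p
0≤*-cancelˡ {r} {p} 0<r 0≤rp = *-cancelˡ-≤-pos′ 0<r (subst (_≤ r * p) (sym (*-zeroʳ r)) 0≤rp)

p≤q⇒0≤q-p : p ≤ q → 0ℚ ≤ q - p
p≤q⇒0≤q-p {p} {q} p≤q = subst (_≤ q - p) (+-inverseʳ p) (+-monoˡ-≤ (- p) p≤q)

0≤q-p⇒p≤q : 0ℚ ≤ q - p → p ≤ q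
0≤q-p⇒p≤q {q} {p} 0≤q-p = begin
  p            ≡⟨ +-identityˡ p ⟨
  0ℚ + p       ≤⟨ +-monoˡ-≤ p 0≤q-p ⟩
  q - p + p    ≡⟨ solve (p ∷ q ∷ []) ℚ-ring ⟩
  q            ∎
  where open ≤-Reasoning

*-mono-≤-nonNeg′ : 0ℚ ≤ p → p ≤ q → 0ℚ ≤ r → r ≤ w → p * r ≤ q * w
*-mono-≤-nonNeg′ 0≤p p≤q 0≤r r≤w =
  ≤-trans (*-monoˡ-≤-nonNeg′ 0≤p r≤w) (*-monoʳ-≤-nonNeg′ (≤-trans 0≤r r≤w) p≤q)

square-mono : 0ℚ ≤ p → p ≤ q → p * p ≤ q * q
square-mono 0≤p p≤q = *-mono-≤-nonNeg′ 0≤p p≤q 0≤p p≤q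

square-cancel : 0ℚ ≤ q → p * p ≤ q * q → p ≤ q
square-cancel {q} {p} 0≤q pp≤qq with p ≤? q
... | yes p≤q = p≤q
... | no  p≰q = ⊥-elim (<-irrefl refl (<-≤-trans qq<pp pp≤qq))
  where
  q<p = ≰⇒> p≰q
  qq<pp : q * q < p * p
  qq<pp = ≤-<-trans (*-monoˡ-≤-nonNeg′ 0≤q (<⇒≤ q<p))
                    (*-monoˡ-<-pos p {{positive (≤-<-trans 0≤q q<p)}} q<p)

0≤ℕ→ℚ : ∀ k → 0ℚ ≤ ℕ→ℚ k
0≤ℕ→ℚ zero    = ≤-refl
0≤ℕ→ℚ (suc k) = subst (0ℚ ≤_) (sym (ℕ→ℚ-suc k)) (+-mono-≤ 0≤1 (0≤ℕ→ℚ k))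

1≤ℕ→ℚ : 1 ℕ.≤ k → 1ℚ ≤ ℕ→ℚ k
1≤ℕ→ℚ {suc k} _ = subst (1ℚ ≤_) (sym (ℕ→ℚ-suc k)) (p≤p+q (0≤ℕ→ℚ k))

-- Finite sums and maxima

∑-mono-≤ : (∀ k → f k ≤ g k) → sum f ≤ sum g
∑-mono-≤ {zero}  f≤g = ≤-refl
∑-mono-≤ {suc n} f≤g = +-mono-≤ (f≤g zero) (∑-mono-≤ (f≤g ∘ suc))

∑-const : sum {n} (λ _ → x) ≡ ℕ→ℚ n * x
∑-const {zero}  {x} = sym (*-zeroˡ x)
∑-const {suc n} {x} = begin
  x + sum {n} (λ _ → x)    ≡⟨ cong (x +_) (∑-const {n}) ⟩
  x + ℕ→ℚ n * x            ≡⟨ cong₂ _+_ (*-identityˡ x) refl ⟨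
  1ℚ * x + ℕ→ℚ n * x       ≡⟨ *-distribʳ-+ x 1ℚ (ℕ→ℚ n) ⟨
  (1ℚ + ℕ→ℚ n) * x         ≡⟨ cong (_* x) (ℕ→ℚ-suc n) ⟨
  ℕ→ℚ (suc n) * x          ∎
  where open ≡-Reasoning

∑-nonNeg : (∀ k → 0ℚ ≤ f k) → 0ℚ ≤ sum f
∑-nonNeg {n} 0≤f = ≤-trans (≤-reflexive (sym (sum-replicate-zero n))) (∑-mono-≤ 0≤f)

term≤∑ : (∀ k → 0ℚ ≤ f k) → ∀ i → f i ≤ sum f
term≤∑ {suc n} {f} 0≤f i = begin
  f i                         ≤⟨ p≤p+q (∑-nonNeg (0≤f ∘ punchIn i)) ⟩
  f i + sum (f ∘ punchIn i)   ≡⟨ sum-remove f ⟨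
  sum f                       ∎
  where open ≤-Reasoning

pair≤∑ : (∀ k → 0ℚ ≤ f k) → ∀ {i j} → i ≢ j → f i + f j ≤ sum f
pair≤∑ {suc n} {f} 0≤f {i} {j} i≢j = begin
  f i + f j                   ≡⟨ cong (λ k → f i + f k) (Fin.punchIn-punchOut i≢j) ⟨
  f i + f (punchIn i j′)      ≤⟨ +-monoʳ-≤ (f i) (term≤∑ (0≤f ∘ punchIn i) j′) ⟩
  f i + sum (f ∘ punchIn i)   ≡⟨ sum-remove f ⟨
  sum f                       ∎
  where
  open ≤-Reasoning
  j′ = punchOut i≢j

∑-update : ∀ {i} → g i ≡ f i + d → (∀ k → k ≢ i → g k ≡ f k) → sum g ≡ sum f + d
∑-update {suc n} {g} {f} {d} {i} gi≡fi+d g≡f = begin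
  sum g                              ≡⟨ sum-remove g ⟩
  g i + sum (g ∘ punchIn i)          ≡⟨ cong₂ _+_ gi≡fi+d (sum-cong-≗ λ k → g≡f _ (Fin.punchInᵢ≢i i k)) ⟩
  f i + d + sum (f ∘ punchIn i)      ≡⟨ +-assoc (f i) d _ ⟩
  f i + (d + sum (f ∘ punchIn i))    ≡⟨ cong (f i +_) (+-comm d _) ⟩
  f i + (sum (f ∘ punchIn i) + d)    ≡⟨ +-assoc (f i) _ d ⟨
  f i + sum (f ∘ punchIn i) + d      ≡⟨ cong (_+ d) (sum-remove f) ⟨
  sum f + d                          ∎
  where open ≡-Reasoning

sumOver : ∀ {A : Set} → (A → ℚ) → List A → ℚ
sumOver f = foldr (λ x s → f x + s) 0ℚ

module _ {A : Set} (f : A → ℚ) where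

  sumOver-++ : ∀ xs ys → sumOver f (xs ++ ys) ≡ sumOver f xs + sumOver f ys
  sumOver-++ []       ys = sym (+-identityˡ _)
  sumOver-++ (x ∷ xs) ys = trans (cong (f x +_) (sumOver-++ xs ys)) (sym (+-assoc (f x) _ _))

  sumOver-↭ : ∀ {xs ys} → xs ↭ ys → sumOver f xs ≡ sumOver f ys
  sumOver-↭ {xs} {ys} xs↭ys = begin
    sumOver f xs               ≡⟨ List.foldr-map _+_ f 0ℚ xs ⟨
    foldr _+_ 0ℚ (map f xs)    ≡⟨ ↭ₛ.foldr-commMonoid (setoid ℚ) +-0-isCommutativeMonoid
                                    (↭⇒↭ₛ (↭.map⁺ f xs↭ys)) ⟩
    foldr _+_ 0ℚ (map f ys)    ≡⟨ List.foldr-map _+_ f 0ℚ ys ⟩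
    sumOver f ys               ∎
    where open ≡-Reasoning

  sumOver-nonNeg : (∀ x → 0ℚ ≤ f x) → ∀ xs → 0ℚ ≤ sumOver f xs
  sumOver-nonNeg 0≤f []       = ≤-refl
  sumOver-nonNeg 0≤f (x ∷ xs) = +-mono-≤ (0≤f x) (sumOver-nonNeg 0≤f xs)

sumOver-tabulate : ∀ {A : Set} (f : A → ℚ) (t : Fin n → A) → sumOver f (tabulate t) ≡ sum (f ∘ t)
sumOver-tabulate {zero}  f t = refl
sumOver-tabulate {suc n} f t = cong (f (t zero) +_) (sumOver-tabulate f (t ∘ suc))

sumOver-allFin : ∀ (f : Fin n → ℚ) → sumOver f (allFin n) ≡ sum f
sumOver-allFin f = sumOver-tabulate f id

≤⊔-either : ∀ x y → w ≤ x ⊎ w ≤ y → w ≤ x ⊔ y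
≤⊔-either x y = [ (λ w≤x → ≤-trans w≤x (p≤p⊔q x y)) , (λ w≤y → ≤-trans w≤y (p≤q⊔p x y)) ]′

module _ {m : ℕ} (L : Fin m → ℚ) where

  ≤-makespan : ∀ k → L k ≤ makespan L
  ≤-makespan k = List.foldr-preservesᵒ ≤⊔-either 0ℚ (map L (allFin m))
                   (inj₂ (Any.map ≤-reflexive (∈-map⁺ L (∈-allFin k))))

  0≤makespan : 0ℚ ≤ makespan L
  0≤makespan = List.foldr-preservesᵒ ≤⊔-either 0ℚ (map L (allFin m)) (inj₁ ≤-refl)

  makespan-preserves : ∀ (P : ℚ → Set) → P 0ℚ → (∀ k → P (L k)) → P (makespan L)
  makespan-preserves P P0 PL =
    List.foldr-preservesᵇ P⊔ P0 (All.map⁺ {P = P} {f = L} (All.tabulate⁺ {P = P ∘ L} {f = id} PL))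
    where
    P⊔ : ∀ {x y} → P x → P y → P (x ⊔ y)
    P⊔ {x} {y} Px Py = [ (λ e → subst P (sym e) Px) , (λ e → subst P (sym e) Py) ]′ (⊔-sel x y)

-- Counting, lists and pigeonhole

if⌊⌋-yes : ∀ {A B : Set} (a? : Dec A) {x y : B} → A → (if ⌊ a? ⌋ then x else y) ≡ x
if⌊⌋-yes (yes _) _ = refl
if⌊⌋-yes (no ¬a) a = ⊥-elim (¬a a)

if⌊⌋-no : ∀ {A B : Set} (a? : Dec A) {x y : B} → ¬ A → (if ⌊ a? ⌋ then x else y) ≡ y
if⌊⌋-no (yes a) ¬a = ⊥-elim (¬a a)
if⌊⌋-no (no _)  _  = refl

module _ {A : Set} {P : Pred A 0ℓ} (P? : Decidable P) where

  count : ∀ {n} → (Fin n → A) → ℕ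
  count {zero}  h = 0
  count {suc n} h = (if ⌊ P? (h zero) ⌋ then 1 else 0) ℕ.+ count (h ∘ suc)

  count-cong : ∀ {n} {h h′ : Fin n → A} → (∀ k → h k ≡ h′ k) → count h ≡ count h′
  count-cong {zero}  h≡h′ = refl
  count-cong {suc n} h≡h′ rewrite h≡h′ zero = cong (_ ℕ.+_) (count-cong (h≡h′ ∘ suc))

  count-all : ∀ {n} {h : Fin n → A} → (∀ k → P (h k)) → count h ≡ n
  count-all {zero}      Ph = refl
  count-all {suc n} {h} Ph with P? (h zero)
  ... | yes _   = cong suc (count-all (Ph ∘ suc))
  ... | no  ¬Ph₀ = ⊥-elim (¬Ph₀ (Ph zero))

  count-witness : ∀ {n} {h : Fin n → A} → 0 ℕ.< count h → ∃ λ k → P (h k)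
  count-witness {suc n} {h} 0<count with P? (h zero)
  ... | yes Ph₀ = zero , Ph₀
  ... | no  _   with count-witness 0<count
  ...   | k , Phₖ = suc k , Phₖ

  count-update : ∀ {n} {h h′ : Fin n → A} {i} → (∀ k → k ≢ i → h′ k ≡ h k) →
                 count h ℕ.≤ suc (count h′)
  count-update {suc n} {h} {h′} {zero} h′≡h = begin
    indicator ℕ.+ count (h ∘ suc)  ≤⟨ ℕ.+-monoˡ-≤ _ (indicator≤1 (⌊ P? (h zero) ⌋)) ⟩
    suc (count (h ∘ suc))          ≡⟨ cong suc (count-cong (λ k → sym (h′≡h (suc k) λ ()))) ⟩
    suc (count (h′ ∘ suc))         ≤⟨ ℕ.s≤s (ℕ.m≤n+m _ _) ⟩
    suc (count h′)                 ∎
    where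
    open ℕ.≤-Reasoning
    indicator = if ⌊ P? (h zero) ⌋ then 1 else 0
    indicator≤1 : ∀ b → (if b then 1 else 0) ℕ.≤ 1
    indicator≤1 true  = ℕ.≤-refl
    indicator≤1 false = ℕ.z≤n
  count-update {suc n} {h} {h′} {suc i} h′≡h rewrite h′≡h zero (λ ()) = begin
    indicator ℕ.+ count (h ∘ suc)        ≤⟨ ℕ.+-monoʳ-≤ indicator (count-update tail≡) ⟩
    indicator ℕ.+ suc (count (h′ ∘ suc)) ≡⟨ ℕ.+-suc indicator _ ⟩
    suc (indicator ℕ.+ count (h′ ∘ suc)) ∎
    where
    open ℕ.≤-Reasoning
    indicator = if ⌊ P? (h zero) ⌋ then 1 else 0
    tail≡ : ∀ k → k ≢ i → h′ (suc k) ≡ h (suc k)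
    tail≡ k k≢i = h′≡h (suc k) (k≢i ∘ Fin.suc-injective)

module _ {A : Set} {R : A → A → Set} where

  AllPairs-++⁻ˡ : ∀ xs {ys} → AllPairs R (xs ++ ys) → AllPairs R xs
  AllPairs-++⁻ˡ []       _                 = AllPairs.[]
  AllPairs-++⁻ˡ (x ∷ xs) (Rx AllPairs.∷ Rxs) = All.++⁻ˡ xs Rx AllPairs.∷ AllPairs-++⁻ˡ xs Rxs

  AllPairs-++⁻-cross : ∀ xs {ys} → AllPairs R (xs ++ ys) → All (λ x → All (R x) ys) xs
  AllPairs-++⁻-cross []       _                 = All.[]
  AllPairs-++⁻-cross (x ∷ xs) (Rx AllPairs.∷ Rxs) = All.++⁻ʳ xs Rx All.∷ AllPairs-++⁻-cross xs Rxs

module _ {A : Set} where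

  length-∷ʳ : ∀ (xs : List A) x → length (xs ++ x ∷ []) ≡ suc (length xs)
  length-∷ʳ xs x = trans (List.length-++ xs) (ℕ.+-comm (length xs) 1)

  Unique-lookup-injective : ∀ {xs : List A} → Unique xs → ∀ i j → lookup xs i ≡ lookup xs j → i ≡ j
  Unique-lookup-injective (_    AllPairs.∷ _)   zero    zero    _ = refl
  Unique-lookup-injective (x∉xs AllPairs.∷ _)   zero    (suc j) e = ⊥-elim (All.lookup x∉xs (∈-lookup j) e)
  Unique-lookup-injective (x∉xs AllPairs.∷ _)   (suc i) zero    e = ⊥-elim (All.lookup x∉xs (∈-lookup i) (sym e))
  Unique-lookup-injective (_    AllPairs.∷ xs!) (suc i) (suc j) e = cong suc (Unique-lookup-injective xs! i j e)

  pigeonhole-Unique : ∀ {m} {xs : List A} (h : A → Fin m) → Unique xs → m ℕ.< length xs →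
                      ∃₂ λ x y → x ∈ xs × y ∈ xs × x ≢ y × h x ≡ h y
  pigeonhole-Unique {xs = xs} h xs! m<len with Fin.pigeonhole m<len (h ∘ lookup xs)
  ... | i , j , i<j , hᵢ≡hⱼ =
    lookup xs i , lookup xs j , ∈-lookup i , ∈-lookup j ,
    (λ e → Fin.<-irrefl (Unique-lookup-injective xs! i j e) i<j) , hᵢ≡hⱼ

-- Numbers a + √D

-- For y ≥ 0, w ≤√D* y encodes w ≤ √D·y and z ≤σ* y encodes z ≤ σ·y with σ = a + √D, by comparing
-- squares; σ≤ v encodes σ ≤ v. This is how GeT1 and LeRatio are stated: GeT1 m x is σ≤ (b·x) and
-- LeRatio m z y is 2m·z ≤σ* y.
module Surd (a D : ℚ) (0≤a : 0ℚ ≤ a) (0≤D : 0ℚ ≤ D) where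

  infix 4 _≤√D*_ _≤σ*_

  data _≤√D*_ (w y : ℚ) : Set where
    nonpos : w ≤ 0ℚ → w ≤√D* y
    square : w * w ≤ D * (y * y) → w ≤√D* y

  √D≤_ : ℚ → Set
  √D≤ v = 0ℚ ≤ v × D ≤ v * v

  record _≤σ*_ (z y : ℚ) : Set where
    constructor via√D
    field excess≤√D* : z - a * y ≤√D* y

  σ≤_ : ℚ → Set
  σ≤ v = √D≤ (v - a)

  σ≤? : ∀ v → Dec (σ≤ v)
  σ≤? v = (0ℚ ≤? v - a) ×-dec (D ≤? (v - a) * (v - a))

  ≤√D*-square : ¬ w ≤ 0ℚ → w ≤√D* y → w * w ≤ D * (y * y)
  ≤√D*-square w≰0 (nonpos w≤0) = ⊥-elim (w≰0 w≤0)
  ≤√D*-square w≰0 (square ww≤) = ww≤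

  √D*-antitone : w′ ≤ w → w ≤√D* y → w′ ≤√D* y
  √D*-antitone {w′} {y = y} w′≤w h with w′ ≤? 0ℚ
  ... | yes w′≤0 = nonpos w′≤0
  ... | no  w′≰0 = square (≤-trans (square-mono (<⇒≤ (≰⇒> w′≰0)) w′≤w)
                                 (≤√D*-square {y = y} (λ w≤0 → w′≰0 (≤-trans w′≤w w≤0)) h))

  √D*-mono : 0ℚ ≤ y → y ≤ y′ → w ≤√D* y → w ≤√D* y′
  √D*-mono 0≤y y≤y′ (nonpos w≤0) = nonpos w≤0
  √D*-mono 0≤y y≤y′ (square ww≤) =
    square (≤-trans ww≤ (*-monoˡ-≤-nonNeg′ 0≤D (square-mono 0≤y y≤y′)))

  √D*-*ˡ : 0ℚ ≤ q → w ≤√D* y → q * w ≤√D* q * y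
  √D*-*ˡ {q} {w} 0≤q (nonpos w≤0) = nonpos (subst (q * w ≤_) (*-zeroʳ q) (*-monoˡ-≤-nonNeg′ 0≤q w≤0))
  √D*-*ˡ {q} {w} {y} 0≤q (square ww≤) = square (begin
    (q * w) * (q * w)       ≡⟨ solve (q ∷ w ∷ []) ℚ-ring ⟩
    (q * q) * (w * w)       ≤⟨ *-monoˡ-≤-nonNeg′ (0≤* 0≤q 0≤q) ww≤ ⟩
    (q * q) * (D * (y * y)) ≡⟨ solve (q ∷ D ∷ y ∷ []) ℚ-ring ⟩
    D * ((q * y) * (q * y)) ∎)
    where open ≤-Reasoning

  √D*-cancelˡ : 0ℚ < q → q * w ≤√D* q * y → w ≤√D* y
  √D*-cancelˡ {q} {w} 0<q (nonpos qw≤0) =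
    nonpos (*-cancelˡ-≤-pos′ 0<q (subst (q * w ≤_) (sym (*-zeroʳ q)) qw≤0))
  √D*-cancelˡ {q} {w} {y} 0<q (square qwqw≤) = square (*-cancelˡ-≤-pos′ 0<qq (begin
    (q * q) * (w * w)       ≡⟨ solve (q ∷ w ∷ []) ℚ-ring ⟩
    (q * w) * (q * w)       ≤⟨ qwqw≤ ⟩
    D * ((q * y) * (q * y)) ≡⟨ solve (q ∷ D ∷ y ∷ []) ℚ-ring ⟩
    (q * q) * (D * (y * y)) ∎))
    where
    open ≤-Reasoning
    0<qq = positive⁻¹ (q * q) {{pos*pos⇒pos q {{positive 0<q}} q {{positive 0<q}}}}

  √D*-+ : 0ℚ ≤ y₁ → 0ℚ ≤ y₂ → w₁ ≤√D* y₁ → w₂ ≤√D* y₂ → w₁ + w₂ ≤√D* y₁ + y₂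
  √D*-+ {y₁} {y₂} {w₁} {w₂} 0≤y₁ 0≤y₂ h₁ h₂ with w₁ ≤? 0ℚ | w₂ ≤? 0ℚ
  ... | yes w₁≤0 | _ =
    √D*-antitone (subst (w₁ + w₂ ≤_) (+-identityˡ w₂) (+-monoˡ-≤ w₂ w₁≤0))
      (√D*-mono 0≤y₂ (subst (_≤ y₁ + y₂) (+-identityˡ y₂) (+-monoˡ-≤ y₂ 0≤y₁)) h₂)
  ... | no _ | yes w₂≤0 =
    √D*-antitone (subst (w₁ + w₂ ≤_) (+-identityʳ w₁) (+-monoʳ-≤ w₁ w₂≤0))
      (√D*-mono 0≤y₁ (p≤p+q 0≤y₂) h₁)
  ... | no w₁≰0 | no w₂≰0 = square (begin
    (w₁ + w₂) * (w₁ + w₂)                           ≡⟨ solve (w₁ ∷ w₂ ∷ []) ℚ-ring ⟩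
    w₁ * w₁ + 2 * (w₁ * w₂) + w₂ * w₂
      ≤⟨ +-mono-≤ (+-mono-≤ s₁ (*-monoˡ-≤-nonNeg′ 0≤2 cross)) s₂ ⟩
    D * (y₁ * y₁) + 2 * (D * (y₁ * y₂)) + D * (y₂ * y₂) ≡⟨ solve (D ∷ y₁ ∷ y₂ ∷ []) ℚ-ring ⟩
    D * ((y₁ + y₂) * (y₁ + y₂))                     ∎)
    where
    open ≤-Reasoning
    s₁ = ≤√D*-square w₁≰0 h₁
    s₂ = ≤√D*-square w₂≰0 h₂
    0≤w₁ = <⇒≤ (≰⇒> w₁≰0)
    0≤w₂ = <⇒≤ (≰⇒> w₂≰0)
    cross : w₁ * w₂ ≤ D * (y₁ * y₂)
    cross = square-cancel (0≤* 0≤D (0≤* 0≤y₁ 0≤y₂)) (begin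
      (w₁ * w₂) * (w₁ * w₂)                 ≡⟨ solve (w₁ ∷ w₂ ∷ []) ℚ-ring ⟩
      (w₁ * w₁) * (w₂ * w₂)               ≤⟨ *-mono-≤-nonNeg′ (0≤* 0≤w₁ 0≤w₁) s₁ (0≤* 0≤w₂ 0≤w₂) s₂ ⟩
      (D * (y₁ * y₁)) * (D * (y₂ * y₂))     ≡⟨ solve (D ∷ y₁ ∷ y₂ ∷ []) ℚ-ring ⟩
      (D * (y₁ * y₂)) * (D * (y₁ * y₂))     ∎)

  √D*-lower : 0ℚ ≤ r → r * r ≤ D → 0ℚ ≤ y → r * y ≤√D* y
  √D*-lower {r} {y} 0≤r rr≤D 0≤y = square (begin
    (r * y) * (r * y)   ≡⟨ solve (r ∷ y ∷ []) ℚ-ring ⟩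
    (r * r) * (y * y)   ≤⟨ *-monoʳ-≤-nonNeg′ (0≤* 0≤y 0≤y) rr≤D ⟩
    D * (y * y)         ∎)
    where open ≤-Reasoning

  √D≤-lower : √D≤ v → 0ℚ ≤ r → r * r ≤ D → r ≤ v
  √D≤-lower (0≤v , D≤vv) 0≤r rr≤D = square-cancel 0≤v (≤-trans rr≤D D≤vv)

  ≰√D : ¬ √D≤ v → v ≤√D* 1ℚ
  ≰√D {v} √D≰v with v ≤? 0ℚ | D ≤? v * v
  ... | yes v≤0 | _       = nonpos v≤0
  ... | no  v≰0 | yes D≤vv = ⊥-elim (√D≰v (<⇒≤ (≰⇒> v≰0) , D≤vv))
  ... | no  _   | no  D≰vv = square (subst (v * v ≤_) (sym (*-identityʳ D)) (<⇒≤ (≰⇒> D≰vv)))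

  0≤σ* : 0ℚ ≤ y → 0ℚ ≤σ* y
  0≤σ* {y} 0≤y = via√D (nonpos (begin
    0ℚ - a * y   ≡⟨ +-identityˡ (- (a * y)) ⟩
    - (a * y)    ≤⟨ neg-antimono-≤ (0≤* 0≤a 0≤y) ⟩
    - 0ℚ         ≡⟨⟩
    0ℚ           ∎))
    where open ≤-Reasoning

  ≤σ*-antitone : z′ ≤ z → z ≤σ* y → z′ ≤σ* y
  ≤σ*-antitone {z′} {z} {y} z′≤z (via√D h) = via√D (√D*-antitone (+-monoˡ-≤ (- (a * y)) z′≤z) h)

  ≤σ*-mono : 0ℚ ≤ y → y ≤ y′ → z ≤σ* y → z ≤σ* y′
  ≤σ*-mono {y} {y′} {z} 0≤y y≤y′ (via√D h) =
    via√D (√D*-antitone (+-monoʳ-≤ z (neg-antimono-≤ (*-monoˡ-≤-nonNeg′ 0≤a y≤y′)))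
                        (√D*-mono 0≤y y≤y′ h))

  ≤σ*-+ : 0ℚ ≤ y₁ → 0ℚ ≤ y₂ → z₁ ≤σ* y₁ → z₂ ≤σ* y₂ → z₁ + z₂ ≤σ* y₁ + y₂
  ≤σ*-+ {y₁} {y₂} {z₁} {z₂} 0≤y₁ 0≤y₂ (via√D h₁) (via√D h₂) =
    via√D (subst (_≤√D* y₁ + y₂) regroup (√D*-+ 0≤y₁ 0≤y₂ h₁ h₂))
    where
    regroup : (z₁ - a * y₁) + (z₂ - a * y₂) ≡ (z₁ + z₂) - a * (y₁ + y₂)
    regroup = solve (a ∷ y₁ ∷ y₂ ∷ z₁ ∷ z₂ ∷ []) ℚ-ring

  private
    *-distrib-excess : ∀ q z y → q * (z - a * y) ≡ q * z - a * (q * y)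
    *-distrib-excess q z y = solve (a ∷ q ∷ y ∷ z ∷ []) ℚ-ring

  ≤σ*-*ˡ : 0ℚ ≤ q → z ≤σ* y → q * z ≤σ* q * y
  ≤σ*-*ˡ {q} {z} {y} 0≤q (via√D h) =
    via√D (subst (_≤√D* q * y) (*-distrib-excess q z y) (√D*-*ˡ 0≤q h))

  ≤σ*-cancelˡ : 0ℚ < q → q * z ≤σ* q * y → z ≤σ* y
  ≤σ*-cancelˡ {q} {z} {y} 0<q (via√D h) =
    via√D (√D*-cancelˡ 0<q (subst (_≤√D* q * y) (sym (*-distrib-excess q z y)) h))

  ≤σ*-lower : 0ℚ ≤ r → r * r ≤ D → 0ℚ ≤ y → (a + r) * y ≤σ* y
  ≤σ*-lower {r} {y} 0≤r rr≤D 0≤y = via√D (subst (_≤√D* y) cancel (√D*-lower 0≤r rr≤D 0≤y))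
    where
    cancel : r * y ≡ (a + r) * y - a * y
    cancel = solve (a ∷ r ∷ y ∷ []) ℚ-ring

  ≰σ : ¬ σ≤ v → v ≤σ* 1ℚ
  ≰σ {v} σ≰v = via√D (subst (λ t → v - t ≤√D* 1ℚ) (sym (*-identityʳ a)) (≰√D σ≰v))

  σ≤-lower : σ≤ v → 0ℚ ≤ r → r * r ≤ D → a + r ≤ v
  σ≤-lower {v} {r} σ≤v 0≤r rr≤D = begin
    a + r            ≤⟨ +-monoʳ-≤ a (√D≤-lower σ≤v 0≤r rr≤D) ⟩
    a + (v - a)      ≡⟨ solve (a ∷ v ∷ []) ℚ-ring ⟩
    v                ∎
    where open ≤-Reasoning

  σ≤-mono : σ≤ v → v ≤ v′ → σ≤ v′
  σ≤-mono {v} {v′} (0≤v-a , D≤) v≤v′ =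
    ≤-trans 0≤v-a v-a≤v′-a , ≤-trans D≤ (square-mono 0≤v-a v-a≤v′-a)
    where v-a≤v′-a = +-monoˡ-≤ (- a) v≤v′

-- The threshold T₁

-- a, b, D stand for 2μ − 1, 3μ − 1, 16μ² − 14μ + 3; they are parameters with their defining equations
-- so that aT m, bT m, DT m can be supplied as they are. Then T₁ = σ/b and the target ratio is σ/(2μ).
module Threshold
  (μ a b D : ℚ) (1≤μ : 1ℚ ≤ μ)
  (a≡ : a ≡ 2 * μ - 1) (b≡ : b ≡ 3 * μ - 1) (D≡ : D ≡ 16 * μ * μ + 3 - 14 * μ)
  where

  0≤μ-1 : 0ℚ ≤ μ - 1
  0≤μ-1 = p≤q⇒0≤q-p 1≤μ

  0≤μ : 0ℚ ≤ μ
  0≤μ = ≤-trans 0≤1 1≤μ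

  0≤2μ : 0ℚ ≤ 2 * μ
  0≤2μ = 0≤* 0≤2 0≤μ

  1≤a : 1ℚ ≤ a
  1≤a = ≤-by-gap (2 * (μ - 1)) (0≤* 0≤2 0≤μ-1) gap
    where
    gap : a ≡ 1ℚ + 2 * (μ - 1)
    gap rewrite a≡ = solve (μ ∷ []) ℚ-ring

  0<a : 0ℚ < a
  0<a = <-≤-trans (positive⁻¹ 1ℚ) 1≤a

  0≤a : 0ℚ ≤ a
  0≤a = <⇒≤ 0<a

  0<b : 0ℚ < b
  0<b = <-≤-trans 0<a (≤-by-gap μ 0≤μ gap)
    where
    gap : b ≡ a + μ
    gap rewrite a≡ | b≡ = solve (μ ∷ []) ℚ-ring

  b≤2a : b ≤ 2 * a
  b≤2a = ≤-by-gap (μ - 1) 0≤μ-1 gap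
    where
    gap : 2 * a ≡ b + (μ - 1)
    gap rewrite a≡ | b≡ = solve (μ ∷ []) ℚ-ring

  2μ≤b : 2 * μ ≤ b
  2μ≤b = ≤-by-gap (μ - 1) 0≤μ-1 gap
    where
    gap : b ≡ 2 * μ + (μ - 1)
    gap rewrite b≡ = solve (μ ∷ []) ℚ-ring

  b≤3a : b ≤ 3 * a
  b≤3a = ≤-by-gap (a + (μ - 1)) (+-mono-≤ 0≤a 0≤μ-1) gap
    where
    gap : 3 * a ≡ b + (a + (μ - 1))
    gap rewrite a≡ | b≡ = solve (μ ∷ []) ℚ-ring

  2a·2a≤D : (2 * a) * (2 * a) ≤ D
  2a·2a≤D = ≤-by-gap a 0≤a gap
    where
    gap : D ≡ (2 * a) * (2 * a) + a
    gap rewrite a≡ | D≡ = solve (μ ∷ []) ℚ-ring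

  0≤D : 0ℚ ≤ D
  0≤D = ≤-trans (0≤* (0≤* 0≤2 0≤a) (0≤* 0≤2 0≤a)) 2a·2a≤D

  open Surd a D 0≤a 0≤D public

  3a*y≤σ*y : 0ℚ ≤ y → 3 * a * y ≤σ* y
  3a*y≤σ*y {y} 0≤y = ≤σ*-antitone (≤-reflexive 3a≡a+2a)
                     (≤σ*-lower (0≤* 0≤2 0≤a) 2a·2a≤D 0≤y)
    where
    3a≡a+2a : 3 * a * y ≡ (a + 2 * a) * y
    3a≡a+2a = solve (a ∷ y ∷ []) ℚ-ring

  b*z≤σ*z : 0ℚ ≤ z → b * z ≤σ* z
  b*z≤σ*z 0≤z = ≤σ*-antitone (*-monoʳ-≤-nonNeg′ 0≤z b≤3a) (3a*y≤σ*y 0≤z)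

  σ≤⇒1≤ : σ≤ (b * z) → 1ℚ ≤ z
  σ≤⇒1≤ {z} σ≤bz = *-cancelˡ-≤-pos′ 0<b (begin
    b * 1ℚ     ≡⟨ *-identityʳ b ⟩
    b          ≤⟨ b≤3a ⟩
    3 * a      ≡⟨ solve (a ∷ []) ℚ-ring ⟩
    a + 2 * a  ≤⟨ σ≤-lower σ≤bz (0≤* 0≤2 0≤a) 2a·2a≤D ⟩
    b * z      ∎)
    where open ≤-Reasoning

  -- σ/b is the positive root of b z² − 2a z − 2a, so σ ≤ b z gives 2a(1 + z) ≤ σ z.
  σ≤-quadratic : σ≤ (b * z) → 2 * a * (1ℚ + z) ≤σ* z
  σ≤-quadratic {z} (_ , D≤vv) =
    via√D (square (0≤q-p⇒p≤q (0≤*-cancelˡ 0<b (subst (0ℚ ≤_) (sym identity) 0≤rhs))))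
    where
    excess = b * z - a
    bound = 2 * a * (1ℚ + z) - a * z
    identity : b * (D * (z * z) - bound * bound) ≡ 2 * a * (excess * excess - D)
    identity rewrite a≡ | b≡ | D≡ = solve (μ ∷ z ∷ []) ℚ-ring
    0≤rhs : 0ℚ ≤ 2 * a * (excess * excess - D)
    0≤rhs = 0≤* (0≤* 0≤2 0≤a) (p≤q⇒0≤q-p D≤vv)

  σ≤-tested : σ≤ (b * z) → b * (1ℚ + z) ≤σ* z
  σ≤-tested {z} σ≤bz = ≤σ*-antitone (*-monoʳ-≤-nonNeg′ 0≤1+z b≤2a) (σ≤-quadratic σ≤bz)
    where
    0≤1+z = ≤-trans 0≤1 (p≤p+q (≤-trans 0≤1 (σ≤⇒1≤ σ≤bz)))

  -- a·(2μ(1 + z) + 3(μ − 1)z) = μ·2a(1 + z) + (μ − 1)·3az, and both terms are bounded via σ.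
  σ≤-late : σ≤ (b * z) → 2 * μ * (1ℚ + z) + 3 * (μ - 1) * z ≤σ* z
  σ≤-late {z} σ≤bz = ≤σ*-cancelˡ 0<a (subst (a * late ≤σ*_) μz+[μ-1]z≡az
    (≤σ*-antitone (≤-reflexive mix)
      (≤σ*-+ (0≤* 0≤μ 0≤z) (0≤* 0≤μ-1 0≤z)
        (≤σ*-*ˡ 0≤μ (σ≤-quadratic σ≤bz))
        (≤σ*-*ˡ 0≤μ-1 (3a*y≤σ*y 0≤z)))))
    where
    late = 2 * μ * (1ℚ + z) + 3 * (μ - 1) * z
    0≤z = ≤-trans 0≤1 (σ≤⇒1≤ σ≤bz)
    mix : a * (2 * μ * (1ℚ + z) + 3 * (μ - 1) * z) ≡ μ * (2 * a * (1ℚ + z)) + (μ - 1) * (3 * a * z)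
    mix = solve (μ ∷ a ∷ z ∷ []) ℚ-ring
    μz+[μ-1]z≡az : μ * z + (μ - 1) * z ≡ a * z
    μz+[μ-1]z≡az rewrite a≡ = solve (μ ∷ z ∷ []) ℚ-ring

  tested-job : σ≤ (b * u) → 0ℚ ≤ p → p ≤ u → b * (1ℚ + p) ≤σ* (1ℚ + p) ⊓ u
  tested-job {u} {p} σ≤bu 0≤p p≤u = [ short , long ]′ (≤-total (1ℚ + p) u)
    where
    short : 1ℚ + p ≤ u → b * (1ℚ + p) ≤σ* (1ℚ + p) ⊓ u
    short 1+p≤u = subst (b * (1ℚ + p) ≤σ*_) (sym (p≤q⇒p⊓q≡p 1+p≤u))
                    (b*z≤σ*z (≤-trans 0≤1 (p≤p+q 0≤p)))
    long : u ≤ 1ℚ + p → b * (1ℚ + p) ≤σ* (1ℚ + p) ⊓ u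
    long u≤1+p = subst (b * (1ℚ + p) ≤σ*_) (sym (p≥q⇒p⊓q≡q u≤1+p))
                   (≤σ*-antitone (*-monoˡ-≤-nonNeg′ (<⇒≤ 0<b) (+-monoʳ-≤ 1ℚ p≤u)) (σ≤-tested σ≤bu))

  untested-job : ¬ σ≤ (b * u) → 0ℚ ≤ u → b * u ≤σ* 1ℚ ⊓ u
  untested-job {u} σ≰bu 0≤u = [ large , small ]′ (≤-total 1ℚ u)
    where
    large : 1ℚ ≤ u → b * u ≤σ* 1ℚ ⊓ u
    large 1≤u = subst (b * u ≤σ*_) (sym (p≤q⇒p⊓q≡p 1≤u)) (≰σ σ≰bu)
    small : u ≤ 1ℚ → b * u ≤σ* 1ℚ ⊓ u
    small u≤1 = subst (b * u ≤σ*_) (sym (p≥q⇒p⊓q≡q u≤1)) (b*z≤σ*z 0≤u)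

  idle-step : ∀ {L d o O} → L ≤ 0ℚ → 0ℚ ≤ d → b * d ≤σ* o → 0ℚ ≤ o → o ≤ O →
              2 * μ * (L + d) ≤σ* O
  idle-step {L} {d} L≤0 0≤d bd≤σo 0≤o o≤O = ≤σ*-mono 0≤o o≤O (≤σ*-antitone (begin
    2 * μ * (L + d)   ≤⟨ *-monoˡ-≤-nonNeg′ 0≤2μ (subst (L + d ≤_) (+-identityˡ d) (+-monoˡ-≤ d L≤0)) ⟩
    2 * μ * d         ≤⟨ *-monoʳ-≤-nonNeg′ 0≤d 2μ≤b ⟩
    b * d             ∎) bd≤σo)
    where open ≤-Reasoning

  busy-untested-step : ∀ {L S R o O u t} →
    μ * L ≤ S → b * S ≤σ* R → 0ℚ ≤ R → R + o ≤ μ * O →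
    b * u ≤σ* t → 0ℚ ≤ t → t ≤ o → 2 * t ≤ O →
    2 * μ * (L + u) ≤σ* O
  busy-untested-step {L} {S} {R} {o} {O} {u} {t} μL≤S bS≤σR 0≤R R+o≤μO bu≤σt 0≤t t≤o 2t≤O =
    ≤σ*-antitone load≤ (≤σ*-cancelˡ 0<b
      (≤σ*-mono (+-mono-≤ (0≤* 0≤2 0≤R) (0≤* 0≤2μ 0≤t)) offline≤
        (≤σ*-antitone (≤-reflexive regroup)
          (≤σ*-+ (0≤* 0≤2 0≤R) (0≤* 0≤2μ 0≤t) (≤σ*-*ˡ 0≤2 bS≤σR) (≤σ*-*ˡ 0≤2μ bu≤σt)))))
    where
    open ≤-Reasoning
    regroup : b * (2 * S + 2 * μ * u) ≡ 2 * (b * S) + 2 * μ * (b * u)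
    regroup = solve (b ∷ μ ∷ S ∷ u ∷ []) ℚ-ring
    2μ+[μ-1]≡3μ-1 : 2 * (μ * O) + (μ - 1) * O ≡ (3 * μ - 1) * O
    2μ+[μ-1]≡3μ-1 = solve (μ ∷ O ∷ []) ℚ-ring
    offline≤ : 2 * R + 2 * μ * t ≤ b * O
    offline≤ = begin
      2 * R + 2 * μ * t                 ≡⟨ solve (μ ∷ R ∷ t ∷ []) ℚ-ring ⟩
      2 * (R + t) + (μ - 1) * (2 * t)  ≤⟨ +-mono-≤ (*-monoˡ-≤-nonNeg′ 0≤2 (+-monoʳ-≤ R t≤o))
                                                    (*-monoˡ-≤-nonNeg′ 0≤μ-1 2t≤O) ⟩
      2 * (R + o) + (μ - 1) * O        ≤⟨ +-monoˡ-≤ ((μ - 1) * O) (*-monoˡ-≤-nonNeg′ 0≤2 R+o≤μO) ⟩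
      2 * (μ * O) + (μ - 1) * O        ≡⟨ 2μ+[μ-1]≡3μ-1 ⟩
      (3 * μ - 1) * O                   ≡⟨ cong (_* O) b≡ ⟨
      b * O                             ∎
    load≤ : 2 * μ * (L + u) ≤ 2 * S + 2 * μ * u
    load≤ = begin
      2 * μ * (L + u)          ≡⟨ solve (μ ∷ L ∷ u ∷ []) ℚ-ring ⟩
      2 * (μ * L) + 2 * μ * u  ≤⟨ +-monoˡ-≤ (2 * μ * u) (*-monoˡ-≤-nonNeg′ 0≤2 μL≤S) ⟩
      2 * S + 2 * μ * u        ∎

  -- Scaled by u, the new load is at most O·(2μ(1 + u) + 3(μ − 1)u), which σ≤-late bounds by σ·u·O.
  busy-tested-step : ∀ {L S R o O u p} →
    μ * L ≤ S → u * S ≤ (1ℚ + u) * R → R + o ≤ μ * O →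
    σ≤ (b * u) → u * (1ℚ + p) ≤ (1ℚ + u) * o → p ≤ o → o ≤ O → 2 ≤ O →
    2 * μ * (L + (1ℚ + p)) ≤σ* O
  busy-tested-step {L} {S} {R} {o} {O} {u} {p} μL≤S uS≤[1+u]R R+o≤μO σ≤bu u[1+p]≤[1+u]o p≤o o≤O 2≤O =
    ≤σ*-cancelˡ 0<u (subst (u * (2 * μ * (L + (1ℚ + p))) ≤σ*_) (*-comm O u)
      (≤σ*-antitone work≤ (≤σ*-*ˡ 0≤O (σ≤-late σ≤bu))))
    where
    open ≤-Reasoning
    0<u = <-≤-trans (positive⁻¹ 1ℚ) (σ≤⇒1≤ σ≤bu)
    0≤u = <⇒≤ 0<u
    0≤O = ≤-trans 0≤2 2≤O
    R≤μO-o : R ≤ μ * O - o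
    R≤μO-o = begin
      R            ≡⟨ solve (R ∷ o ∷ []) ℚ-ring ⟩
      R + o - o    ≤⟨ +-monoˡ-≤ (- o) R+o≤μO ⟩
      μ * O - o    ∎
    earlier≤ : u * (μ * L) ≤ (1ℚ + u) * (μ * O - o)
    earlier≤ = begin
      u * (μ * L)            ≤⟨ *-monoˡ-≤-nonNeg′ 0≤u μL≤S ⟩
      u * S                  ≤⟨ uS≤[1+u]R ⟩
      (1ℚ + u) * R           ≤⟨ *-monoˡ-≤-nonNeg′ (≤-trans 0≤1 (p≤p+q 0≤u)) R≤μO-o ⟩
      (1ℚ + u) * (μ * O - o) ∎
    2[1+p]≤3O : 2 * (1ℚ + p) ≤ 3 * O
    2[1+p]≤3O = begin
      2 * (1ℚ + p)   ≡⟨ solve (p ∷ []) ℚ-ring ⟩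
      2 + 2 * p      ≤⟨ +-mono-≤ 2≤O (*-monoˡ-≤-nonNeg′ 0≤2 (≤-trans p≤o o≤O)) ⟩
      O + 2 * O      ≡⟨ solve (O ∷ []) ℚ-ring ⟩
      3 * O          ∎
    work≤ : u * (2 * μ * (L + (1ℚ + p))) ≤ O * (2 * μ * (1ℚ + u) + 3 * (μ - 1) * u)
    work≤ = begin
      u * (2 * μ * (L + (1ℚ + p)))
        ≡⟨ solve (u ∷ μ ∷ L ∷ p ∷ []) ℚ-ring ⟩
      2 * (u * (μ * L)) + 2 * (u * (1ℚ + p)) + (μ - 1) * (u * (2 * (1ℚ + p)))
        ≤⟨ +-mono-≤ (+-mono-≤ (*-monoˡ-≤-nonNeg′ 0≤2 earlier≤)
                              (*-monoˡ-≤-nonNeg′ 0≤2 u[1+p]≤[1+u]o))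
                    (*-monoˡ-≤-nonNeg′ 0≤μ-1 (*-monoˡ-≤-nonNeg′ 0≤u 2[1+p]≤3O)) ⟩
      2 * ((1ℚ + u) * (μ * O - o)) + 2 * ((1ℚ + u) * o) + (μ - 1) * (u * (3 * O))
        ≡⟨ solve (u ∷ μ ∷ O ∷ o ∷ []) ℚ-ring ⟩
      O * (2 * μ * (1ℚ + u) + 3 * (μ - 1) * u) ∎

-- Uniform-SBS

tested-late-job : 0ℚ ≤ t → t ≤ u → 0ℚ ≤ p → p ≤ u → t * (1ℚ + p) ≤ (1ℚ + t) * ((1ℚ + p) ⊓ u)
tested-late-job {t} {u} {p} 0≤t t≤u 0≤p p≤u = [ short , long ]′ (≤-total (1ℚ + p) u)
  where
  open ≤-Reasoning
  short : 1ℚ + p ≤ u → t * (1ℚ + p) ≤ (1ℚ + t) * ((1ℚ + p) ⊓ u)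
  short 1+p≤u = begin
    t * (1ℚ + p)                ≤⟨ *-monoʳ-≤-nonNeg′ (≤-trans 0≤1 (p≤p+q 0≤p))
                                     (subst (_≤ 1ℚ + t) (+-identityˡ t) (+-monoˡ-≤ t 0≤1)) ⟩
    (1ℚ + t) * (1ℚ + p)         ≡⟨ cong ((1ℚ + t) *_) (p≤q⇒p⊓q≡p 1+p≤u) ⟨
    (1ℚ + t) * ((1ℚ + p) ⊓ u)   ∎
  long : u ≤ 1ℚ + p → t * (1ℚ + p) ≤ (1ℚ + t) * ((1ℚ + p) ⊓ u)
  long u≤1+p = begin
    t * (1ℚ + p)                ≤⟨ *-monoˡ-≤-nonNeg′ 0≤t (+-monoʳ-≤ 1ℚ p≤u) ⟩
    t * (1ℚ + u)                ≡⟨ expand ⟩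
    t + t * u                   ≤⟨ +-monoˡ-≤ (t * u) t≤u ⟩
    u + t * u                   ≡⟨ factor ⟩
    (1ℚ + t) * u                ≡⟨ cong ((1ℚ + t) *_) (p≥q⇒p⊓q≡q u≤1+p) ⟨
    (1ℚ + t) * ((1ℚ + p) ⊓ u)   ∎
    where
    expand : t * (1ℚ + u) ≡ t + t * u
    expand = solve (t ∷ u ∷ []) ℚ-ring
    factor : u + t * u ≡ (1ℚ + t) * u
    factor = solve (t ∷ u ∷ []) ℚ-ring

aT≡ : ∀ m → aT m ≡ 2 * ℕ→ℚ m - 1
aT≡ m = cong (_- 1ℚ) (ℕ→ℚ-* 2 m)

bT≡ : ∀ m → bT m ≡ 3 * ℕ→ℚ m - 1
bT≡ m = cong (_- 1ℚ) (ℕ→ℚ-* 3 m)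

DT≡ : ∀ m → DT m ≡ 16 * ℕ→ℚ m * ℕ→ℚ m + 3 - 14 * ℕ→ℚ m
DT≡ m = cong₂ _-_ (trans (ℕ→ℚ-+ (16 ℕ.* m ℕ.* m) 3)
                         (cong (_+ 3) (trans (ℕ→ℚ-* (16 ℕ.* m) m) (cong (_* ℕ→ℚ m) (ℕ→ℚ-* 16 m)))))
                  (ℕ→ℚ-* 14 m)

module Schedule
  (m n : ℕ) (1≤m : 1 ℕ.≤ m)
  (u p : Fin n → ℚ) (0≤p : ∀ j → 0ℚ ≤ p j) (p≤u : ∀ j → p j ≤ u j)
  (π : List (Fin n)) (π-sorted : SortedOrder u π)
  (σ : Fin n → Fin m)
  where

  μ : ℚ
  μ = ℕ→ℚ m

  open Threshold μ (aT m) (bT m) (DT m) (1≤ℕ→ℚ 1≤m) (aT≡ m) (bT≡ m) (DT≡ m)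

  0≤u : ∀ j → 0ℚ ≤ u j
  0≤u j = ≤-trans (0≤p j) (p≤u j)

  o : Fin n → ℚ
  o j = (1ℚ + p j) ⊓ u j

  1≤1+p : ∀ j → 1ℚ ≤ 1ℚ + p j
  1≤1+p j = p≤p+q (0≤p j)

  0≤o : ∀ j → 0ℚ ≤ o j
  0≤o j = ⊓-glb (≤-trans 0≤1 (1≤1+p j)) (0≤u j)

  p≤o : ∀ j → p j ≤ o j
  p≤o j = ⊓-glb (subst (_≤ 1ℚ + p j) (+-identityˡ (p j)) (+-monoˡ-≤ (p j) 0≤1)) (p≤u j)

  1⊓u≤o : ∀ {j x} → u j ≤ u x → 1ℚ ⊓ u j ≤ o x
  1⊓u≤o {x = x} uj≤ux = ⊓-mono-≤ (1≤1+p x) uj≤ux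

  O : ℚ
  O = makespan (offlineLoad u p σ)

  0≤O : 0ℚ ≤ O
  0≤O = 0≤makespan (offlineLoad u p σ)

  δ : Fin m → Fin n → ℚ
  δ k j = if ⌊ σ j ≟ k ⌋ then o j else 0ℚ

  offlineLoad≡∑δ : ∀ k → offlineLoad u p σ k ≡ sum (δ k)
  offlineLoad≡∑δ k = sumOver-allFin (δ k)

  0≤δ : ∀ k j → 0ℚ ≤ δ k j
  0≤δ k j with σ j ≟ k
  ... | yes _ = 0≤o j
  ... | no  _ = ≤-refl

  δ-on : ∀ j → δ (σ j) j ≡ o j
  δ-on j = if⌊⌋-yes (σ j ≟ σ j) refl

  ∑δ : ∀ j → sum (λ k → δ k j) ≡ o j
  ∑δ j = begin
    sum (λ k → δ k j)          ≡⟨ ∑-update (trans (δ-on j) (sym (+-identityˡ (o j))))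
                                           (λ k k≢σj → if⌊⌋-no (σ j ≟ k) (k≢σj ∘ sym)) ⟩
    sum {m} (λ _ → 0ℚ) + o j   ≡⟨ cong (_+ o j) (sum-replicate-zero m) ⟩
    0ℚ + o j                   ≡⟨ +-identityˡ (o j) ⟩
    o j                        ∎
    where open ≡-Reasoning

  o≤O : ∀ j → o j ≤ O
  o≤O j = begin
    o j                              ≡⟨ δ-on j ⟨
    δ (σ j) j                        ≤⟨ term≤∑ (0≤δ (σ j)) j ⟩
    sum (δ (σ j))                    ≡⟨ offlineLoad≡∑δ (σ j) ⟨
    offlineLoad u p σ (σ j)          ≤⟨ ≤-makespan (offlineLoad u p σ) (σ j) ⟩
    O                                ∎
    where open ≤-Reasoning

  o+o≤O : ∀ {x y} → x ≢ y → σ x ≡ σ y → o x + o y ≤ O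
  o+o≤O {x} {y} x≢y σx≡σy = begin
    o x + o y                        ≡⟨ cong₂ _+_ (δ-on x) (trans (cong (λ k → δ k y) σx≡σy) (δ-on y)) ⟨
    δ (σ x) x + δ (σ x) y            ≤⟨ pair≤∑ (0≤δ (σ x)) x≢y ⟩
    sum (δ (σ x))                    ≡⟨ offlineLoad≡∑δ (σ x) ⟨
    offlineLoad u p σ (σ x)          ≤⟨ ≤-makespan (offlineLoad u p σ) (σ x) ⟩
    O                                ∎
    where open ≤-Reasoning

  ∑o≤μO : sum o ≤ μ * O
  ∑o≤μO = begin
    sum o                            ≡⟨ sum-cong-≗ ∑δ ⟨
    sum (λ j → sum (λ k → δ k j))    ≡⟨ ∑-comm δ ⟨
    sum (λ k → sum (δ k))            ≡⟨ sum-cong-≗ offlineLoad≡∑δ ⟨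
    sum (offlineLoad u p σ)          ≤⟨ ∑-mono-≤ (≤-makespan (offlineLoad u p σ)) ⟩
    sum {m} (λ _ → O)                ≡⟨ ∑-const {n = m} ⟩
    μ * O                            ∎
    where open ≤-Reasoning

  act : Fin n → ℚ
  act j = if ⌊ σ≤? (bT m * u j) ⌋ then 1ℚ + p j else u j

  act-tested : ∀ {j} → σ≤ (bT m * u j) → act j ≡ 1ℚ + p j
  act-tested {j} = if⌊⌋-yes (σ≤? (bT m * u j))

  act-untested : ∀ {j} → ¬ σ≤ (bT m * u j) → act j ≡ u j
  act-untested {j} = if⌊⌋-no (σ≤? (bT m * u j))

  act-cases : ∀ (P : ℚ → Set) j → (σ≤ (bT m * u j) → P (1ℚ + p j)) → (¬ σ≤ (bT m * u j) → P (u j)) →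
              P (act j)
  act-cases P j if-tested if-untested = by-decision (σ≤? (bT m * u j))
    where
    by-decision : (tested? : Dec (σ≤ (bT m * u j))) → P (if ⌊ tested? ⌋ then 1ℚ + p j else u j)
    by-decision (yes σ≤buⱼ) = if-tested σ≤buⱼ
    by-decision (no  σ≰buⱼ) = if-untested σ≰buⱼ

  0≤act : ∀ j → 0ℚ ≤ act j
  0≤act j = act-cases (0ℚ ≤_) j (λ _ → ≤-trans 0≤1 (1≤1+p j)) (λ _ → 0≤u j)

  act≤σ*o : ∀ j → bT m * act j ≤σ* o j
  act≤σ*o j = act-cases (λ d → bT m * d ≤σ* o j) j
    (λ σ≤buⱼ → tested-job σ≤buⱼ (0≤p j) (p≤u j))
    (λ σ≰buⱼ → ≤σ*-mono (⊓-glb 0≤1 (0≤u j)) (1⊓u≤o ≤-refl) (untested-job σ≰buⱼ (0≤u j)))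

  act-late : σ≤ (bT m * t) → ∀ {x} → t ≤ u x → t * act x ≤ (1ℚ + t) * o x
  act-late {t} σ≤bt {x} t≤ux =
    subst (λ d → t * d ≤ (1ℚ + t) * o x)
          (sym (act-tested (σ≤-mono σ≤bt (*-monoˡ-≤-nonNeg′ (<⇒≤ 0<b) t≤ux))))
      (tested-late-job (≤-trans 0≤1 (σ≤⇒1≤ σ≤bt)) t≤ux (0≤p x) (p≤u x))

  ∑act≤σ*∑o : ∀ xs → bT m * sumOver act xs ≤σ* sumOver o xs
  ∑act≤σ*∑o []       = ≤σ*-antitone (≤-reflexive (*-zeroʳ (bT m))) (0≤σ* ≤-refl)
  ∑act≤σ*∑o (x ∷ xs) = ≤σ*-antitone (≤-reflexive (*-distribˡ-+ (bT m) (act x) (sumOver act xs)))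
                         (≤σ*-+ (0≤o x) (sumOver-nonNeg o 0≤o xs) (act≤σ*o x) (∑act≤σ*∑o xs))

  ∑act-late : σ≤ (bT m * t) → ∀ {xs} → All (λ x → t ≤ u x) xs →
              t * sumOver act xs ≤ (1ℚ + t) * sumOver o xs
  ∑act-late {t} σ≤bt {[]}     All.[]          = ≤-reflexive (trans (*-zeroʳ t) (sym (*-zeroʳ (1ℚ + t))))
  ∑act-late {t} σ≤bt {x ∷ xs} (t≤ux All.∷ t≤u) = begin
    t * (act x + sumOver act xs)               ≡⟨ *-distribˡ-+ t (act x) _ ⟩
    t * act x + t * sumOver act xs             ≤⟨ +-mono-≤ (act-late σ≤bt t≤ux) (∑act-late σ≤bt t≤u) ⟩
    (1ℚ + t) * o x + (1ℚ + t) * sumOver o xs   ≡⟨ *-distribˡ-+ (1ℚ + t) (o x) _ ⟨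
    (1ℚ + t) * (o x + sumOver o xs)            ∎
    where open ≤-Reasoning

  module Prefix {pre j js} (split : pre ++ j ∷ js ≡ π) where

    prefix≡ : (pre ++ j ∷ []) ++ js ≡ π
    prefix≡ = trans (List.++-assoc pre (j ∷ []) js) split

    unique : Unique (pre ++ j ∷ [])
    unique = AllPairs-++⁻ˡ (pre ++ j ∷ []) (subst Unique (sym prefix≡) π-unique)
      where
      π-unique : Unique π
      π-unique = ↭ₛ.Unique-resp-↭ (setoid (Fin n)) (↭⇒↭ₛ (↭-sym (proj₁ π-sorted))) (allFin⁺ n)

    dominated : All (λ x → u j ≤ u x) (pre ++ j ∷ [])
    dominated = All.++⁺ (All.map All.head (AllPairs-++⁻-cross pre (subst (AllPairs _) (sym split) π-pairs)))
                        (≤-refl All.∷ All.[])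
      where
      π-pairs = Linked⇒AllPairs (λ uy≤ux uz≤uy → ≤-trans uz≤uy uy≤ux) (proj₂ π-sorted)

    offline : sumOver o pre + o j ≤ μ * O
    offline = begin
      sumOver o pre + o j                  ≤⟨ +-monoʳ-≤ (sumOver o pre) (p≤p+q (sumOver-nonNeg o 0≤o js)) ⟩
      sumOver o pre + sumOver o (j ∷ js)   ≡⟨ sumOver-++ o pre (j ∷ js) ⟨
      sumOver o (pre ++ j ∷ js)            ≡⟨ cong (sumOver o) split ⟩
      sumOver o π                          ≡⟨ sumOver-↭ o (proj₁ π-sorted) ⟩
      sumOver o (allFin n)                 ≡⟨ sumOver-allFin o ⟩
      sum o                                ≤⟨ ∑o≤μO ⟩
      μ * O                                ∎
      where open ≤-Reasoning

    prefix-length : m ℕ.≤ length pre → m ℕ.< length (pre ++ j ∷ [])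
    prefix-length m≤|pre| =
      subst (m ℕ.<_) (sym (length-∷ʳ pre j)) (ℕ.s≤s m≤|pre|)

    shared-machine : m ℕ.≤ length pre → 2 * (1ℚ ⊓ u j) ≤ O
    shared-machine m≤|pre| with pigeonhole-Unique σ unique (prefix-length m≤|pre|)
    ... | x , y , x∈ , y∈ , x≢y , σx≡σy = begin
      2 * (1ℚ ⊓ u j)           ≡⟨ double (1ℚ ⊓ u j) ⟩
      1ℚ ⊓ u j + 1ℚ ⊓ u j      ≤⟨ +-mono-≤ (1⊓u≤o (All.lookup dominated x∈))
                                           (1⊓u≤o (All.lookup dominated y∈)) ⟩
      o x + o y                ≤⟨ o+o≤O x≢y σx≡σy ⟩
      O                        ∎
      where
      open ≤-Reasoning
      double : ∀ x → 2 * x ≡ x + x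
      double x = solve (x ∷ []) ℚ-ring

  addLoad-at : ∀ (L : Fin m → ℚ) i d → addLoad L i d i ≡ L i + d
  addLoad-at L i d = if⌊⌋-yes (i ≟ i) refl

  addLoad-off : ∀ (L : Fin m → ℚ) {i} d {k} → k ≢ i → addLoad L i d k ≡ L k
  addLoad-off L {i} d {k} = if⌊⌋-no (k ≟ i)

  μ*min≤∑ : ∀ {L : Fin m → ℚ} {i} → (∀ k → L i ≤ L k) → μ * L i ≤ sum L
  μ*min≤∑ {L} {i} min = subst (_≤ sum L) (∑-const {n = m}) (∑-mono-≤ min)

  idle : (Fin m → ℚ) → ℕ
  idle = count (_≤? 0ℚ)

  Invariant : List (Fin n) → (Fin m → ℚ) → Set
  Invariant pre L = (∀ k → 2 * μ * L k ≤σ* O) × (sum L ≡ sumOver act pre) × (m ℕ.≤ idle L ℕ.+ length pre)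

  invariant-start : Invariant [] (λ _ → 0ℚ)
  invariant-start =
    (λ _ → ≤σ*-antitone (≤-reflexive (*-zeroʳ (2 * μ))) (0≤σ* 0≤O)) ,
    sum-replicate-zero m ,
    ℕ.≤-reflexive (sym (trans (ℕ.+-identityʳ _) (count-all (_≤? 0ℚ) (λ _ → ≤-refl))))

  module Step {pre j js} (split : pre ++ j ∷ js ≡ π) {L : Fin m → ℚ} {i} (min : ∀ k → L i ≤ L k)
              (inv : Invariant pre L) where
    open Prefix split

    bounded : ∀ k → 2 * μ * L k ≤σ* O
    bounded = proj₁ inv

    total : sum L ≡ sumOver act pre
    total = proj₁ (proj₂ inv)

    enough-idle : m ℕ.≤ idle L ℕ.+ length pre
    enough-idle = proj₂ (proj₂ inv)

    μLᵢ≤S : μ * L i ≤ sumOver act pre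
    μLᵢ≤S = subst (μ * L i ≤_) total (μ*min≤∑ min)

    busy : m ℕ.≤ length pre → 2 * μ * (L i + act j) ≤σ* O
    busy m≤|pre| = act-cases (λ d → 2 * μ * (L i + d) ≤σ* O) j
      (λ σ≤buⱼ → let 1≤uⱼ = σ≤⇒1≤ σ≤buⱼ in
        busy-tested-step μLᵢ≤S (∑act-late σ≤buⱼ (All.++⁻ˡ pre dominated)) offline σ≤buⱼ
          (tested-late-job (≤-trans 0≤1 1≤uⱼ) ≤-refl (0≤p j) (p≤u j)) (p≤o j) (o≤O j)
          (subst (λ t → 2 * t ≤ O) (p≤q⇒p⊓q≡p 1≤uⱼ) (shared-machine m≤|pre|)))
      (λ σ≰buⱼ →
        busy-untested-step μLᵢ≤S (∑act≤σ*∑o pre) (sumOver-nonNeg o 0≤o pre) offline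
          (untested-job σ≰buⱼ (0≤u j)) (⊓-glb 0≤1 (0≤u j)) (1⊓u≤o ≤-refl)
          (shared-machine m≤|pre|))

    new-load : 2 * μ * (L i + act j) ≤σ* O
    new-load = by-idle (1 ℕ.≤? idle L)
      where
      by-idle : Dec (1 ℕ.≤ idle L) → 2 * μ * (L i + act j) ≤σ* O
      by-idle (yes some-idle) =
        let k , Lₖ≤0 = count-witness (_≤? 0ℚ) some-idle
        in idle-step (≤-trans (min k) Lₖ≤0) (0≤act j) (act≤σ*o j) (0≤o j) (o≤O j)
      by-idle (no no-idle) =
        busy (subst (λ c → m ℕ.≤ c ℕ.+ length pre) (ℕ.n<1⇒n≡0 (ℕ.≰⇒> no-idle)) enough-idle)

    next : ∀ {d} → act j ≡ d → Invariant (pre ++ j ∷ []) (addLoad L i d)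
    next refl = bounded′ , total′ , enough-idle′
      where
      L′ = addLoad L i (act j)

      bounded′ : ∀ k → 2 * μ * L′ k ≤σ* O
      bounded′ k = at-or-off (k ≟ i)
        where
        at-or-off : Dec (k ≡ i) → 2 * μ * L′ k ≤σ* O
        at-or-off (yes refl) = subst (λ l → 2 * μ * l ≤σ* O) (sym (addLoad-at L i (act j))) new-load
        at-or-off (no  k≢i)  = subst (λ l → 2 * μ * l ≤σ* O) (sym (addLoad-off L (act j) k≢i)) (bounded k)

      total′ : sum L′ ≡ sumOver act (pre ++ j ∷ [])
      total′ = begin
        sum L′                                   ≡⟨ ∑-update (addLoad-at L i (act j)) (λ _ → addLoad-off L (act j)) ⟩
        sum L + act j                            ≡⟨ cong₂ _+_ total (sym (+-identityʳ (act j))) ⟩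
        sumOver act pre + sumOver act (j ∷ [])   ≡⟨ sumOver-++ act pre (j ∷ []) ⟨
        sumOver act (pre ++ j ∷ [])              ∎
        where open ≡-Reasoning

      enough-idle′ : m ℕ.≤ idle L′ ℕ.+ length (pre ++ j ∷ [])
      enough-idle′ = begin
        m                                    ≤⟨ enough-idle ⟩
        idle L ℕ.+ length pre                ≤⟨ ℕ.+-monoˡ-≤ (length pre) (count-update (_≤? 0ℚ) (λ _ → addLoad-off L (act j))) ⟩
        suc (idle L′) ℕ.+ length pre         ≡⟨ ℕ.+-suc (idle L′) (length pre) ⟨
        idle L′ ℕ.+ suc (length pre)         ≡⟨ cong (idle L′ ℕ.+_) (length-∷ʳ pre j) ⟨
        idle L′ ℕ.+ length (pre ++ j ∷ [])   ∎
        where open ℕ.≤-Reasoning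

  run-bounded : ∀ {L js L′} → SBSRun m u p L js L′ → ∀ {pre} → pre ++ js ≡ π → Invariant pre L →
                ∀ k → 2 * μ * L′ k ≤σ* O
  run-bounded (done _) _ inv = proj₁ inv
  run-bounded (tested L j js i L′ min σ≤buⱼ run) {pre} split inv =
    run-bounded run (trans (List.++-assoc pre (j ∷ []) js) split) (Step.next split min inv (act-tested σ≤buⱼ))
  run-bounded (untested L j js i L′ min σ≰buⱼ run) {pre} split inv =
    run-bounded run (trans (List.++-assoc pre (j ∷ []) js) split) (Step.next split min inv (act-untested σ≰buⱼ))

  ≤σ*⇒LeRatio : 2 * μ * z ≤σ* O → LeRatio m z O
  ≤σ*⇒LeRatio {z} (via√D h) =
    subst (λ c → c * z - aT m * O ≤ 0ℚ ⊎ (c * z - aT m * O) * (c * z - aT m * O) ≤ DT m * (O * O))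
          (sym (ℕ→ℚ-* 2 m)) (as-sum h)
    where
    as-sum : ∀ {w} → w ≤√D* O → w ≤ 0ℚ ⊎ w * w ≤ DT m * (O * O)
    as-sum (nonpos w≤0)  = inj₁ w≤0
    as-sum (square ww≤)  = inj₂ ww≤

  makespan-bounded : ∀ {L} → SBSRun m u p (λ _ → 0ℚ) π L → LeRatio m (makespan L) O
  makespan-bounded {L} run = ≤σ*⇒LeRatio (makespan-preserves L (λ z → 2 * μ * z ≤σ* O)
    (≤σ*-antitone (≤-reflexive (*-zeroʳ (2 * μ))) (0≤σ* 0≤O))
    (run-bounded run refl invariant-start))

theorem4 : (m n : ℕ) → m ≥ 1 →
    (u p : Fin n → ℚ) →
    (∀ j → 0ℚ ≤ p j) → (∀ j → p j ≤ u j) →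
    (π : List (Fin n)) → SortedOrder u π →
    (L : Fin m → ℚ) → SBSRun m u p (λ _ → 0ℚ) π L →
    (σ : Fin n → Fin m) →
    LeRatio m (makespan L) (makespan (offlineLoad u p σ))
theorem4 m n 1≤m u p 0≤p p≤u π sorted L run σ =
  Schedule.makespan-bounded m n 1≤m u p 0≤p p≤u π sorted σ run
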